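{- $\mathfrak a_s\le\bar{\mathfrak o}$.
   Context: Two infinite sets are almost disjoint if their intersection is finite. $\mathfrak a_s$ is the minimum cardinality of a family $\mathcal Q$ of infinite subsets of $\omega\times\omega$ such that each member of $\mathcal Q$ meets each column $\{n\}\times\omega$ in at most one point, members of $\mathcal Q$ are pairwise almost disjoint, and $\mathcal Q$ is maximal with these properties (no infinite subset of $\omega\times\omega$ meeting each column in at most one point is almost disjoint from every member of $\mathcal Q$). Let ${}^{<\omega}\omega$ be the tree of finite sequences of natural numbers ordered by initial segment. An antichain is a set of pairwise incomparable nodes. $\bar{\mathfrak o}$ is the minimum cardinality of a maximal almost disjoint family of infinite antichains of ${}^{<\omega}\omega$ (i.e. a pairwise almost disjoint family of infinite antichains such that no infinite antichain is almost disjoint from all of its members). -}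

module Defs where

open import Data.Nat using (ℕ; _<_)
open import Data.Bool using (Bool; true; _∧_)
open import Data.List using (List; []; _∷_)
open import Data.List.Membership.Propositional using (_∈_)
open import Data.Product using (Σ; _×_)
open import Relation.Nullary using (¬_)
open import Relation.Binary.PropositionalEquality using (_≡_; _≢_)

-- Subsets of ω × ω (as characteristic functions; the ambient logic is
-- classical, see the ExcludedMiddle hypothesis of the theorem)

Sub² : Set
Sub² = ℕ → ℕ → Bool

_∈²_ : ℕ × ℕ → Sub² → Set
_∈²_ (n Data.Product., m) A = A n m ≡ true

_∩²_ : Sub² → Sub² → Sub²
(A ∩² B) n m = A n m ∧ B n m

Finite² : Sub² → Set
Finite² A = Σ ℕ λ N → ∀ n m → A n m ≡ true → (n < N) × (m < N)

Infinite² : Sub² → Set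
Infinite² A = ¬ Finite² A

AlmostDisjoint² : Sub² → Sub² → Set
AlmostDisjoint² A B = Finite² (A ∩² B)

ColumnSelective : Sub² → Set
ColumnSelective A = ∀ n m m′ → A n m ≡ true → A n m′ ≡ true → m ≡ m′

IsMaximalASFamily : {J : Set} → (J → Sub²) → Set
IsMaximalASFamily {J} Q =
  (∀ j → Infinite² (Q j) × ColumnSelective (Q j))
  × (∀ j j′ → j ≢ j′ → AlmostDisjoint² (Q j) (Q j′))
  × (∀ (B : Sub²) → Infinite² B → ColumnSelective B →
       ¬ (∀ j → AlmostDisjoint² B (Q j)))

Node : Set
Node = List ℕ

data _⊑_ : Node → Node → Set where
  []⊑ : ∀ {t} → [] ⊑ t
  ∷⊑  : ∀ {x s t} → s ⊑ t → (x ∷ s) ⊑ (x ∷ t)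

Incomparable : Node → Node → Set
Incomparable s t = ¬ (s ⊑ t) × ¬ (t ⊑ s)

SubT : Set
SubT = Node → Bool

_∩T_ : SubT → SubT → SubT
(A ∩T B) s = A s ∧ B s

FiniteT : SubT → Set
FiniteT A = Σ (List Node) λ L → ∀ s → A s ≡ true → s ∈ L

InfiniteT : SubT → Set
InfiniteT A = ¬ FiniteT A

AlmostDisjointT : SubT → SubT → Set
AlmostDisjointT A B = FiniteT (A ∩T B)

Antichain : SubT → Set
Antichain A = ∀ s t → A s ≡ true → A t ≡ true → s ≢ t → Incomparable s t

IsMADAntichainFamily : {I : Set} → (I → SubT) → Set
IsMADAntichainFamily {I} 𝒜 =
  (∀ i → InfiniteT (𝒜 i) × Antichain (𝒜 i))
  × (∀ i i′ → i ≢ i′ → AlmostDisjointT (𝒜 i) (𝒜 i′))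
  × (∀ (B : SubT) → InfiniteT B → Antichain B →
       ¬ (∀ i → AlmostDisjointT B (𝒜 i)))

{-# OPTIONS --safe #-}

-- Embed ω × ω into the tree by (n , m) ↦ n ∷ 0ᵐ.  Each column goes to a chain and
-- distinct columns to pairwise incomparable nodes, so column-selective sets are
-- exactly the preimages of antichains.  Pulling back a MAD family of antichains
-- and discarding the members with finite preimage gives a maximal family for 𝔞_s:
-- an infinite column-selective B maps to an infinite antichain, which meets some
-- member infinitely, and that member then cannot have a finite preimage.
module Submission where

open import Defs
open import Level using (0ℓ)
open import Axiom.ExcludedMiddle using (ExcludedMiddle)
open import Data.Product using (Σ; _×_)
open import Function.Bundles using (_↣_)

open import Data.Bool using (true; _∧_)
open import Data.Bool.Properties using (∧-conicalˡ; ∧-conicalʳ)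
open import Data.Empty using (⊥-elim)
open import Data.Irrelevant using ([_])
open import Data.List using (List; []; _∷_; replicate; length; map; upTo; cartesianProduct)
open import Data.List.Extrema.Nat using (max; xs≤max)
open import Data.List.Membership.Propositional using (_∈_)
open import Data.List.Membership.Propositional.Properties using (∈-map⁺; ∈-upTo⁺; ∈-cartesianProduct⁺)
open import Data.List.Properties using (length-replicate; ≡-dec)
open import Data.List.Relation.Unary.All using (lookup)
open import Data.Nat using (ℕ; zero; suc; _≤_; _<_; _⊔_; s≤s; _≟_)
open import Data.Nat.Properties using (≤-total; ≤-trans; m≤m⊔n; m≤n⊔m)
open import Data.Product using (_,_; proj₁; proj₂; uncurry; ∃-syntax)
open import Data.Refinement using (Refinement-syntax; _,_; value)
open import Data.Refinement.Properties using (value-injective)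
open import Data.Sum as Sum using (_⊎_; [_,_]′)
open import Function using (_∘_)
open import Function.Bundles using (mk↣)
open import Relation.Binary.Definitions using (DecidableEquality)
open import Relation.Binary.PropositionalEquality using (_≡_; _≢_; refl; sym; trans; cong; cong₂; subst; module ≡-Reasoning)
open import Relation.Nullary using (¬_; yes; no; does)
open import Relation.Nullary.Decidable using (dec-true)
open import Relation.Nullary.Recomputable using (¬-recompute)

embed : ℕ → ℕ → Node
embed n m = n ∷ replicate m 0

coords : Node → ℕ × ℕ
coords []      = 0 , 0
coords (n ∷ t) = n , length t

coords-embed : ∀ n m → coords (embed n m) ≡ (n , m)
coords-embed n m = cong (n ,_) (length-replicate m)

embed-injective : ∀ {n n′ m m′} → embed n m ≡ embed n′ m′ → (n , m) ≡ (n′ , m′)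
embed-injective {n} {n′} {m} {m′} eq =
  trans (sym (coords-embed n m)) (trans (cong coords eq) (coords-embed n′ m′))

replicate-⊑ : ∀ {m m′} (x : ℕ) → m ≤ m′ → replicate m x ⊑ replicate m′ x
replicate-⊑ {zero}          x _          = []⊑
replicate-⊑ {suc m} {suc m′} x (s≤s m≤m′) = ∷⊑ (replicate-⊑ x m≤m′)

embed-comparable : ∀ n m m′ → embed n m ⊑ embed n m′ ⊎ embed n m′ ⊑ embed n m
embed-comparable n m m′ = Sum.map (∷⊑ ∘ replicate-⊑ 0) (∷⊑ ∘ replicate-⊑ 0) (≤-total m m′)

⊑-head : ∀ {x y s t} → (x ∷ s) ⊑ (y ∷ t) → x ≡ y
⊑-head (∷⊑ _) = refl

_≟ₙ_ : DecidableEquality Node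
_≟ₙ_ = ≡-dec _≟_

preimage : SubT → Sub²
preimage A n m = A (embed n m)

image : Sub² → SubT
image B s = does (s ≟ₙ uncurry embed (coords s)) ∧ uncurry B (coords s)

image-embed : ∀ B {n m} → B n m ≡ true → image B (embed n m) ≡ true
image-embed B {n} {m} Bnm = begin
  does (embed n m ≟ₙ uncurry embed (coords (embed n m))) ∧ uncurry B (coords (embed n m))
    ≡⟨ cong (λ p → does (embed n m ≟ₙ uncurry embed p) ∧ uncurry B p) (coords-embed n m) ⟩
  does (embed n m ≟ₙ embed n m) ∧ B n m
    ≡⟨ cong₂ _∧_ (dec-true (embed n m ≟ₙ embed n m) refl) Bnm ⟩
  true ∎
  where open ≡-Reasoning

image-members : ∀ B s → image B s ≡ true → ∃[ n ] ∃[ m ] s ≡ embed n m × B n m ≡ true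
image-members B s Bs with s ≟ₙ uncurry embed (coords s)
... | yes s≡embed = _ , _ , s≡embed , Bs

Finite²-⊆ : ∀ {A B} → (∀ n m → A n m ≡ true → B n m ≡ true) → Finite² B → Finite² A
Finite²-⊆ A⊆B (N , bounded) = N , λ n m Anm → bounded n m (A⊆B n m Anm)

Finite²-fromList : ∀ {A : Sub²} (L : List (ℕ × ℕ)) → (∀ n m → A n m ≡ true → (n , m) ∈ L) → Finite² A
Finite²-fromList {A} L A⊆L = suc (max 0 widths) , bounded
  where
  widths : List ℕ
  widths = map (uncurry _⊔_) L

  bounded : ∀ n m → A n m ≡ true → (n < suc (max 0 widths)) × (m < suc (max 0 widths))
  bounded n m Anm = s≤s (≤-trans (m≤m⊔n n m) n⊔m≤max) , s≤s (≤-trans (m≤n⊔m n m) n⊔m≤max)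
    where
    n⊔m≤max : n ⊔ m ≤ max 0 widths
    n⊔m≤max = lookup (xs≤max 0 widths) (∈-map⁺ (uncurry _⊔_) (A⊆L n m Anm))

Finite²-toList : ∀ {A} → Finite² A → Σ (List (ℕ × ℕ)) λ L → ∀ n m → A n m ≡ true → (n , m) ∈ L
Finite²-toList (N , bounded) = cartesianProduct (upTo N) (upTo N) , λ n m Anm →
  ∈-cartesianProduct⁺ (∈-upTo⁺ (proj₁ (bounded n m Anm))) (∈-upTo⁺ (proj₂ (bounded n m Anm)))

preimage-finite : ∀ {A} → FiniteT A → Finite² (preimage A)
preimage-finite (L , A⊆L) = Finite²-fromList (map coords L) λ n m Anm →
  subst (_∈ map coords L) (coords-embed n m) (∈-map⁺ coords (A⊆L (embed n m) Anm))

FiniteT-⊆-embed : ∀ {A C} → Finite² C →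
  (∀ s → A s ≡ true → ∃[ n ] ∃[ m ] s ≡ embed n m × C n m ≡ true) → FiniteT A
FiniteT-⊆-embed {C = C} finC A⊆C with Finite²-toList finC
... | L , C⊆L = map (uncurry embed) L , λ s As → embedded (A⊆C s As)
  where
  embedded : ∀ {s} → ∃[ n ] ∃[ m ] s ≡ embed n m × C n m ≡ true → s ∈ map (uncurry embed) L
  embedded (n , m , refl , Cnm) = ∈-map⁺ (uncurry embed) (C⊆L n m Cnm)

preimage-columnSelective : ∀ {A} → Antichain A → ColumnSelective (preimage A)
preimage-columnSelective anti n m m′ Am Am′ with m ≟ m′
... | yes m≡m′ = m≡m′
... | no m≢m′ = ⊥-elim ([ proj₁ incomparable , proj₂ incomparable ]′ (embed-comparable n m m′))
  where
  incomparable : Incomparable (embed n m) (embed n m′)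
  incomparable = anti _ _ Am Am′ (m≢m′ ∘ cong proj₂ ∘ embed-injective)

image-antichain : ∀ {B} → ColumnSelective B → Antichain (image B)
image-antichain {B} select s t Bs Bt s≢t with image-members B s Bs | image-members B t Bt
... | n , m , refl , Bnm | n′ , m′ , refl , Bn′m′ =
  differentColumns ∘ ⊑-head , differentColumns ∘ sym ∘ ⊑-head
  where
  differentColumns : n ≢ n′
  differentColumns refl = s≢t (cong (embed n) (select n m m′ Bnm Bn′m′))

image-infinite : ∀ {B} → Infinite² B → InfiniteT (image B)
image-infinite {B} infB = infB ∘ Finite²-⊆ (λ n m → image-embed B) ∘ preimage-finite

image-almostDisjoint : ∀ {A} B → Finite² (B ∩² preimage A) → AlmostDisjointT (image B) A
image-almostDisjoint {A} B finB∩A = FiniteT-⊆-embed finB∩A members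
  where
  members : ∀ s → (image B ∩T A) s ≡ true → ∃[ n ] ∃[ m ] s ≡ embed n m × (B ∩² preimage A) n m ≡ true
  members s Bs∩As with image-members B s (∧-conicalˡ _ _ Bs∩As)
  ... | n , m , refl , Bnm = n , m , refl , cong₂ _∧_ Bnm (∧-conicalʳ (image B s) _ Bs∩As)

theorem4p3 : ExcludedMiddle 0ℓ →
    (I : Set) (𝒜 : I → SubT) → IsMADAntichainFamily 𝒜 →
    Σ Set λ J → Σ (J → Sub²) λ Q → IsMaximalASFamily Q × (J ↣ I)
theorem4p3 em I 𝒜 (infinite-antichain , almostDisjoint , maximal) =
  J , Q , (Q-infinite-selective , Q-almostDisjoint , Q-maximal) , mk↣ value-injective
  where
  -- The membership proof is irrelevant, so `value` is injective without funext.
  J : Set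
  J = [ i ∈ I ∣ Infinite² (preimage (𝒜 i)) ]

  Q : J → Sub²
  Q j = preimage (𝒜 (value j))

  Q-infinite-selective : ∀ j → Infinite² (Q j) × ColumnSelective (Q j)
  Q-infinite-selective (i , [ infinite ]) =
    ¬-recompute infinite , preimage-columnSelective (proj₂ (infinite-antichain i))

  Q-almostDisjoint : ∀ j j′ → j ≢ j′ → AlmostDisjoint² (Q j) (Q j′)
  Q-almostDisjoint j j′ j≢j′ =
    preimage-finite (almostDisjoint (value j) (value j′) (j≢j′ ∘ value-injective))

  Q-maximal : ∀ B → Infinite² B → ColumnSelective B → ¬ (∀ j → AlmostDisjoint² B (Q j))
  Q-maximal B infB selectB B⊥Q =
    maximal (image B) (image-infinite infB) (image-antichain selectB) (image-almostDisjoint B ∘ meets)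
    where
    meets : ∀ i → Finite² (B ∩² preimage (𝒜 i))
    meets i with em {Finite² (preimage (𝒜 i))}
    ... | yes finite = Finite²-⊆ (λ n m → ∧-conicalʳ (B n m) _) finite
    ... | no infinite = B⊥Q (i , [ infinite ])
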